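{- Let $A=\{a_0<a_1<a_2\}$ be a set of integers and $\mathbf{r}=(r_0,r_1,r_2)$ an ordered $3$-tuple of positive integers. Suppose $h$ is an integer with $2\le h\le r_0+r_1+r_2-2$. Then: (i) if $r_1=1$, then $|h^{(\mathbf{r})}A|=L(\mathbf{r},h)$; (ii) if $r_1\ge 2$, then $|h^{(\mathbf{r})}A|=L(\mathbf{r},h)$ if and only if $A$ is a $3$-term arithmetic progression.
   Context: Here $k=3$. Define $$h^{(\mathbf{r})}A=\Big\{\sum_{i=0}^{k-1}s_ia_i:\ s_i\in\mathbb{Z},\ 0\le s_i\le r_i,\ \sum_{i=0}^{k-1}s_i=h\Big\}.$$ Empty sums are $0$. Let $I_{\mathbf{r}}(h)$ be the largest integer (with $0\le I_{\mathbf{r}}(h)\le k$) such that $\sum_{j=0}^{I_{\mathbf{r}}(h)-1}r_j\le h$, and $M_{\mathbf{r}}(h)$ the least integer (with $-1\le M_{\mathbf{r}}(h)\le k-1$) such that $\sum_{j=M_{\mathbf{r}}(h)+1}^{k-1}r_j\le h$. Put $\delta_{\mathbf{r}}(h)=h-\sum_{j=0}^{I_{\mathbf{r}}(h)-1}r_j$, $\theta_{\mathbf{r}}(h)=h-\sum_{j=M_{\mathbf{r}}(h)+1}^{k-1}r_j$, and $$L(\mathbf{r},h)=\sum_{j=M_{\mathbf{r}}(h)+1}^{k-1}j r_j-\sum_{j=0}^{I_{\mathbf{r}}(h)-1}j r_j+M_{\mathbf{r}}(h)\,\theta_{\mathbf{r}}(h)-I_{\mathbf{r}}(h)\,\delta_{\mathbf{r}}(h)+1.$$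 -}

module Defs where

open import Data.Nat as ℕ using (ℕ; zero; suc; _≤ᵇ_)
open import Data.Integer as ℤ using (ℤ; +_; -[1+_])
open import Data.List using (List; []; [_]; concatMap; upTo; length; deduplicate)
open import Data.Bool using (Bool; if_then_else_)
open import Relation.Nullary.Decidable using (⌊_⌋)

sumList : (r0 r1 r2 h : ℕ) (a0 a1 a2 : ℤ) → List ℤ
sumList r0 r1 r2 h a0 a1 a2 =
  concatMap (λ s0 →
    concatMap (λ s1 →
      concatMap (λ s2 →
        if ⌊ s0 ℕ.+ s1 ℕ.+ s2 ℕ.≟ h ⌋
          then [ (+ s0) ℤ.* a0 ℤ.+ (+ s1) ℤ.* a1 ℤ.+ (+ s2) ℤ.* a2 ]
          else [])
      (upTo (suc r2)))
    (upTo (suc r1)))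
  (upTo (suc r0))

sumsetCard : (r0 r1 r2 h : ℕ) (a0 a1 a2 : ℤ) → ℕ
sumsetCard r0 r1 r2 h a0 a1 a2 = length (deduplicate ℤ._≟_ (sumList r0 r1 r2 h a0 a1 a2))

-- I_r(h): largest I ∈ {0,1,2,3} with r_0 + ... + r_{I-1} ≤ h.
Ir : (r0 r1 r2 h : ℕ) → ℕ
Ir r0 r1 r2 h =
  if r0 ℕ.+ r1 ℕ.+ r2 ≤ᵇ h then 3
  else if r0 ℕ.+ r1 ≤ᵇ h then 2
  else if r0 ≤ᵇ h then 1
  else 0

prefix : (r0 r1 r2 i : ℕ) → ℕ
prefix r0 r1 r2 0 = 0
prefix r0 r1 r2 1 = r0
prefix r0 r1 r2 2 = r0 ℕ.+ r1
prefix r0 r1 r2 (suc (suc (suc _))) = r0 ℕ.+ r1 ℕ.+ r2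

wprefix : (r0 r1 r2 i : ℕ) → ℕ
wprefix r0 r1 r2 0 = 0
wprefix r0 r1 r2 1 = 0 ℕ.* r0
wprefix r0 r1 r2 2 = 0 ℕ.* r0 ℕ.+ 1 ℕ.* r1
wprefix r0 r1 r2 (suc (suc (suc _))) = 0 ℕ.* r0 ℕ.+ 1 ℕ.* r1 ℕ.+ 2 ℕ.* r2

-- M_r(h): least M ∈ {-1,0,1,2} with r_{M+1} + ... + r_2 ≤ h.
Mr : (r0 r1 r2 h : ℕ) → ℤ
Mr r0 r1 r2 h =
  if r0 ℕ.+ r1 ℕ.+ r2 ≤ᵇ h then -[1+ 0 ]
  else if r1 ℕ.+ r2 ≤ᵇ h then + 0
  else if r2 ≤ᵇ h then + 1
  else + 2

suffix : (r0 r1 r2 : ℕ) → ℤ → ℕ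
suffix r0 r1 r2 -[1+ _ ] = r0 ℕ.+ r1 ℕ.+ r2
suffix r0 r1 r2 (+ 0) = r1 ℕ.+ r2
suffix r0 r1 r2 (+ 1) = r2
suffix r0 r1 r2 (+ suc (suc _)) = 0

wsuffix : (r0 r1 r2 : ℕ) → ℤ → ℕ
wsuffix r0 r1 r2 -[1+ _ ] = 0 ℕ.* r0 ℕ.+ 1 ℕ.* r1 ℕ.+ 2 ℕ.* r2
wsuffix r0 r1 r2 (+ 0) = 1 ℕ.* r1 ℕ.+ 2 ℕ.* r2
wsuffix r0 r1 r2 (+ 1) = 2 ℕ.* r2
wsuffix r0 r1 r2 (+ suc (suc _)) = 0

δr : (r0 r1 r2 h : ℕ) → ℤ
δr r0 r1 r2 h = + h ℤ.- + prefix r0 r1 r2 (Ir r0 r1 r2 h)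

θr : (r0 r1 r2 h : ℕ) → ℤ
θr r0 r1 r2 h = + h ℤ.- + suffix r0 r1 r2 (Mr r0 r1 r2 h)

L : (r0 r1 r2 h : ℕ) → ℤ
L r0 r1 r2 h =
  + wsuffix r0 r1 r2 (Mr r0 r1 r2 h)
  ℤ.- + wprefix r0 r1 r2 (Ir r0 r1 r2 h)
  ℤ.+ Mr r0 r1 r2 h ℤ.* θr r0 r1 r2 h
  ℤ.- + Ir r0 r1 r2 h ℤ.* δr r0 r1 r2 h
  ℤ.+ + 1

IsAP3 : ℤ → ℤ → ℤ → Set
IsAP3 a0 a1 a2 = a1 ℤ.- a0 ≡ a2 ℤ.- a1
  where open import Relation.Binary.PropositionalEquality using (_≡_)

{-# OPTIONS --safe #-}
-- Give a coefficient vector s = (s₀, s₁, s₂), 0 ≤ sᵢ ≤ rᵢ, Σ sᵢ = h, the weight s₁ + 2 s₂. Moving one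
-- unit from slot i to slot i + 1 raises the weight by one and strictly raises Σ sᵢ aᵢ, and such a move
-- exists unless the weight is already the largest one; dually downwards. Walking from any vector down
-- to the least and up to the largest weight gives a strictly increasing chain of L sums, L being the
-- difference of the extreme weights plus one, so |h^(r)A| ≥ L. When the sum depends only on the weight
-- (A an arithmetic progression, or r₁ = 1, when the weight determines s) every sum lies on that chain.
-- Otherwise, for r₁ ≥ 2, some vector P of weight t admits both moves; as A is not a progression the
-- two results, of weight t + 1, have distinct sums, both below that of the vector R of weight t + 2
-- obtained by doing both moves, so a chain through P and R has L + 1 elements.
module Submission where

open import Defs
open import Data.Nat as ℕ using (ℕ)
open import Data.Integer as ℤ using (ℤ; +_)
open import Data.Product using (_×_)
open import Function.Bundles using (_⇔_)
open import Relation.Binary.PropositionalEquality using (_≡_)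

open import Data.Nat using (zero; suc; pred; z≤n; s≤s; _+_; _*_; _∸_; _⊓_; _⊔_; _≤_; _<_; _≤?_; _≤ᵇ_)
open import Data.Nat.Properties
open import Data.Nat.DivMod using (_%_; [m+kn]%n≡m%n; m<n⇒m%n≡m)
import Data.Integer.Properties as ℤP
open import Data.Bool using (true; false; if_then_else_)
open import Data.Bool.Properties using (T-≡; ¬-not)
open import Data.Product using (Σ-syntax; ∃-syntax; _,_)
open import Data.Sum using (_⊎_; inj₁; inj₂)
open import Data.Empty using (⊥-elim)
open import Data.List using (List; []; _∷_; _++_; [_]; length; map)
open import Data.List.Properties using (length-++; length-++-sucʳ; length-map)
open import Data.List.Membership.Propositional using (_∈_; find; lose)
import Data.List.Membership.Propositional.Properties as ∈
open import Data.List.Relation.Binary.Subset.Propositional using (_⊆_)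
open import Data.List.Relation.Unary.Any as Any using (Any; here; there)
import Data.List.Relation.Unary.Any.Properties as Any
import Data.List.Relation.Unary.All as All
open import Data.List.Relation.Unary.Linked as Linked using (Linked; [-])
import Data.List.Relation.Unary.Linked.Properties as LinkedP
open import Data.List.Relation.Unary.AllPairs as AllPairs using (AllPairs)
open import Data.List.Relation.Unary.Unique.Propositional using (Unique)
import Data.List.Relation.Unary.Unique.Propositional.Properties as Unique
open import Data.List.Relation.Unary.Unique.DecPropositional.Properties ℤ._≟_ using (deduplicate-!)
open import Function.Base using (_∘_)
open import Function.Bundles using (Equivalence; mk⇔)
open import Algebra.Bundles using (AbelianGroup)
open import Algebra.Properties.Group (AbelianGroup.group ℤP.+-0-abelianGroup) using (∙-cancelˡ)
open import Level using (0ℓ)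
open import Relation.Binary.Core using (Rel)
open import Relation.Binary.Definitions using (Tri; tri<; tri≈; tri>)
open import Relation.Binary.PropositionalEquality using (refl; sym; trans; cong; cong₂; subst; subst₂; module ≡-Reasoning)
open import Relation.Nullary using (¬_; yes; no)
open import Relation.Nullary.Decidable using (⌊_⌋; decidable-stable)
import Data.Nat.Tactic.RingSolver as ℕRing
open ℕRing using (solve)
import Data.Integer.Tactic.RingSolver as ℤRing

-- Duplicate-free lists and monotone walks

Unique-⊆⇒length≤ : ∀ {A : Set} {xs ys : List A} → Unique xs → xs ⊆ ys → length xs ≤ length ys
Unique-⊆⇒length≤ {xs = []} _ _ = z≤n
Unique-⊆⇒length≤ {xs = x ∷ xs} {ys} (x∉xs AllPairs.∷ u) xs⊆ys with ∈.∈-∃++ (xs⊆ys (here refl))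
... | us , vs , refl = subst (suc (length xs) ≤_) (sym (length-++-sucʳ us x vs))
                         (s≤s (Unique-⊆⇒length≤ u xs⊆us++vs))
  where
  xs⊆us++vs : xs ⊆ us ++ vs
  xs⊆us++vs {v} v∈xs with ∈.∈-++⁻ us (xs⊆ys (there v∈xs))
  ... | inj₁ v∈us = ∈.∈-++⁺ˡ v∈us
  ... | inj₂ (here refl) = ⊥-elim (All.lookup x∉xs v∈xs refl)
  ... | inj₂ (there v∈vs) = ∈.∈-++⁺ʳ us v∈vs

valley-Unique : ∀ {a : ℤ} {ds us} → Linked ℤ._>_ (a ∷ ds) → Linked ℤ._<_ (a ∷ us) → Unique ((a ∷ ds) ++ us)
valley-Unique {a} {ds} {us} down up =
  Unique.++⁺ (AllPairs.map (λ i>j i≡j → ℤP.<⇒≢ i>j (sym i≡j)) down-pairs)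
             (AllPairs.map ℤP.<⇒≢ (AllPairs.tail up-pairs)) disjoint
  where
  down-pairs : AllPairs ℤ._>_ (a ∷ ds)
  down-pairs = LinkedP.Linked⇒AllPairs (λ i>j j>k → ℤP.<-trans j>k i>j) down
  up-pairs : AllPairs ℤ._<_ (a ∷ us)
  up-pairs = LinkedP.Linked⇒AllPairs ℤP.<-trans up
  ≤a : ∀ {v} → v ∈ a ∷ ds → v ℤ.≤ a
  ≤a (here refl) = ℤP.≤-refl
  ≤a (there v∈ds) = ℤP.<⇒≤ (All.lookup (AllPairs.head down-pairs) v∈ds)
  disjoint : ∀ {v} → ¬ (v ∈ a ∷ ds × v ∈ us)
  disjoint (v∈ds , v∈us) = ℤP.≤⇒≯ (≤a v∈ds) (All.lookup (AllPairs.head up-pairs) v∈us)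

⊆-++ : ∀ {A : Set} {xs ys zs : List A} → xs ⊆ zs → ys ⊆ zs → xs ++ ys ⊆ zs
⊆-++ {xs = xs} xs⊆zs ys⊆zs v∈ with ∈.∈-++⁻ xs v∈
... | inj₁ v∈xs = xs⊆zs v∈xs
... | inj₂ v∈ys = ys⊆zs v∈ys

record Walk {P A : Set} (R : Rel A 0ℓ) (μ : P → ℕ) (f : P → A) (p : P) : Set where
  field
    path : List P
    length-path : length path ≡ μ p
    linked : Linked R (f p ∷ map f path)
    visits : ∀ {m} → m ≤ μ p → Any (λ q → μ q ≡ m) (p ∷ path)

module _ {P A : Set} {R : Rel A 0ℓ} {μ : P → ℕ} {f : P → A} where

  Walk-[] : ∀ {p} → μ p ≡ 0 → Walk R μ f p
  Walk-[] μp≡0 = record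
    { path = [] ; length-path = sym μp≡0 ; linked = [-]
    ; visits = λ m≤μp → here (trans μp≡0 (sym (n≤0⇒n≡0 (subst (_ ≤_) μp≡0 m≤μp)))) }

  Walk-∷ : ∀ {p q n} → μ p ≡ suc n → μ q ≡ n → R (f p) (f q) → Walk R μ f q → Walk R μ f p
  Walk-∷ {p} {q} {n} μp≡1+n μq≡n Rpq w = record
    { path = q ∷ path
    ; length-path = trans (cong suc (trans length-path μq≡n)) (sym μp≡1+n)
    ; linked = Rpq Linked.∷ linked
    ; visits = visits′ }
    where
    open Walk w
    visits′ : ∀ {m} → m ≤ μ p → Any (λ r → μ r ≡ m) (p ∷ q ∷ path)
    visits′ m≤μp with m≤n⇒m<n∨m≡n (subst (_ ≤_) μp≡1+n m≤μp)
    ... | inj₁ m<1+n = there (visits (subst (_ ≤_) (sym μq≡n) (≤-pred m<1+n)))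
    ... | inj₂ m≡1+n = here (trans μp≡1+n (sym m≡1+n))

  opaque
    walk : (∀ p {n} → μ p ≡ suc n → Σ[ q ∈ P ] μ q ≡ n × R (f p) (f q)) → ∀ p → Walk R μ f p
    walk step p = go (μ p) p refl
      where
      go : ∀ n p → μ p ≡ n → Walk R μ f p
      go zero p μp≡0 = Walk-[] μp≡0
      go (suc n) p μp≡1+n with step p μp≡1+n
      ... | q , μq≡n , Rpq = Walk-∷ μp≡1+n μq≡n Rpq (go n q μq≡n)

-- The extreme weights and L

m+o≡n⇒m≤n : ∀ {m n} o → m + o ≡ n → m ≤ n
m+o≡n⇒m≤n o refl = m≤m+n _ o

maxWeight : ℕ → ℕ → ℕ → ℕ
maxWeight r₁ r₂ h = (2 * h) ⊓ (h + r₂) ⊓ (r₁ + 2 * r₂)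

minWeight : ℕ → ℕ → ℕ → ℕ
minWeight r₀ r₁ h = (h ∸ r₀) ⊔ (2 * h ∸ (2 * r₀ + r₁))

y+2*z≤maxWeight : ∀ {r₁ r₂} x {y z} → y ≤ r₁ → z ≤ r₂ → y + 2 * z ≤ maxWeight r₁ r₂ (x + y + z)
y+2*z≤maxWeight x {y} {z} y≤r₁ z≤r₂ with m≤n⇒∃[o]m+o≡n y≤r₁ | m≤n⇒∃[o]m+o≡n z≤r₂
... | d , refl | e , refl = ⊓-glb (⊓-glb ≤2h ≤h+r₂) ≤r₁+2r₂
  where
  ≤2h : y + 2 * z ≤ 2 * (x + y + z)
  ≤2h = m+o≡n⇒m≤n (2 * x + y) (solve (x ∷ y ∷ z ∷ []))
  ≤h+r₂ : y + 2 * z ≤ x + y + z + (z + e)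
  ≤h+r₂ = m+o≡n⇒m≤n (x + e) (solve (x ∷ y ∷ z ∷ e ∷ []))
  ≤r₁+2r₂ : y + 2 * z ≤ y + d + 2 * (z + e)
  ≤r₁+2r₂ = m+o≡n⇒m≤n (d + 2 * e) (solve (y ∷ z ∷ d ∷ e ∷ []))

minWeight≤y+2*z : ∀ {r₀ r₁} {x y} z → x ≤ r₀ → y ≤ r₁ → minWeight r₀ r₁ (x + y + z) ≤ y + 2 * z
minWeight≤y+2*z {x = x} {y} z x≤r₀ y≤r₁ with m≤n⇒∃[o]m+o≡n x≤r₀ | m≤n⇒∃[o]m+o≡n y≤r₁
... | e , refl | d , refl = ⊔-lub (m≤n+o⇒m∸n≤o _ (x + e) h≤) (m≤n+o⇒m∸n≤o _ (2 * (x + e) + (y + d)) 2h≤)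
  where
  h≤ : x + y + z ≤ x + e + (y + 2 * z)
  h≤ = m+o≡n⇒m≤n (e + z) (solve (x ∷ y ∷ z ∷ e ∷ []))
  2h≤ : 2 * (x + y + z) ≤ 2 * (x + e) + (y + d) + (y + 2 * z)
  2h≤ = m+o≡n⇒m≤n (2 * e + d) (solve (x ∷ y ∷ z ∷ e ∷ d ∷ []))

maxWeight≤y+2*z : ∀ {r₁ r₂ x y z} → 1 ≤ r₁ → (x ≡ 0 ⊎ r₁ ≤ y) → (y ≡ 0 ⊎ r₂ ≤ z) →
                   maxWeight r₁ r₂ (x + y + z) ≤ y + 2 * z
maxWeight≤y+2*z _ (inj₁ refl) (inj₁ refl) = ≤-trans (m⊓n≤m _ _) (m⊓n≤m _ _)
maxWeight≤y+2*z {r₁} {r₂} {y = y} {z} _ (inj₁ refl) (inj₂ r₂≤z) = begin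
  maxWeight r₁ r₂ (y + z) ≤⟨ ≤-trans (m⊓n≤m _ _) (m⊓n≤n _ _) ⟩
  y + z + r₂              ≤⟨ +-monoʳ-≤ (y + z) r₂≤z ⟩
  y + z + z               ≡⟨ solve (y ∷ z ∷ []) ⟩
  y + 2 * z               ∎
  where open ≤-Reasoning
maxWeight≤y+2*z 1≤r₁ (inj₂ r₁≤y) (inj₁ refl) with ≤-trans 1≤r₁ r₁≤y
... | ()
maxWeight≤y+2*z _ (inj₂ r₁≤y) (inj₂ r₂≤z) = ≤-trans (m⊓n≤n _ _) (+-mono-≤ r₁≤y (*-monoʳ-≤ 2 r₂≤z))

y+2*z≤minWeight : ∀ {r₀ r₁ x y z} → 1 ≤ r₁ → (y ≡ 0 ⊎ r₀ ≤ x) → (z ≡ 0 ⊎ r₁ ≤ y) →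
                   y + 2 * z ≤ minWeight r₀ r₁ (x + y + z)
y+2*z≤minWeight _ (inj₁ refl) (inj₁ refl) = z≤n
y+2*z≤minWeight 1≤r₁ (inj₁ refl) (inj₂ r₁≤y) with ≤-trans 1≤r₁ r₁≤y
... | ()
y+2*z≤minWeight {r₀} {y = y} _ (inj₂ r₀≤x) (inj₁ refl) with m≤n⇒∃[o]m+o≡n r₀≤x
... | e , refl = ≤-trans (m+n≤o⇒m≤o∸n _ y+r₀≤h) (m≤m⊔n _ _)
  where
  y+r₀≤h : y + 2 * 0 + r₀ ≤ r₀ + e + y + 0
  y+r₀≤h = m+o≡n⇒m≤n e (solve (r₀ ∷ y ∷ e ∷ []))
y+2*z≤minWeight {r₀} {r₁} {z = z} _ (inj₂ r₀≤x) (inj₂ r₁≤y) with m≤n⇒∃[o]m+o≡n r₀≤x | m≤n⇒∃[o]m+o≡n r₁≤y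
... | e , refl | d , refl = ≤-trans (m+n≤o⇒m≤o∸n _ w+2r₀+r₁≤2h) (m≤n⊔m _ _)
  where
  w+2r₀+r₁≤2h : r₁ + d + 2 * z + (2 * r₀ + r₁) ≤ 2 * (r₀ + e + (r₁ + d) + z)
  w+2r₀+r₁≤2h = m+o≡n⇒m≤n (2 * e + d) (solve (r₀ ∷ r₁ ∷ z ∷ e ∷ d ∷ []))

maxWeight-≥r₁+r₂ : ∀ r₁ r₂ {h} → r₁ + r₂ ≤ h → maxWeight r₁ r₂ h ≡ r₁ + 2 * r₂
maxWeight-≥r₁+r₂ r₁ r₂ r₁+r₂≤h with m≤n⇒∃[o]m+o≡n r₁+r₂≤h
... | e , refl = m≥n⇒m⊓n≡n (⊓-glb ≤2h ≤h+r₂)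
  where
  ≤2h : r₁ + 2 * r₂ ≤ 2 * (r₁ + r₂ + e)
  ≤2h = m+o≡n⇒m≤n (r₁ + 2 * e) (solve (r₁ ∷ r₂ ∷ e ∷ []))
  ≤h+r₂ : r₁ + 2 * r₂ ≤ r₁ + r₂ + e + r₂
  ≤h+r₂ = m+o≡n⇒m≤n e (solve (r₁ ∷ r₂ ∷ e ∷ []))

maxWeight-≥r₂ : ∀ r₁ r₂ {h} → r₂ ≤ h → h ≤ r₁ + r₂ → maxWeight r₁ r₂ h ≡ h + r₂
maxWeight-≥r₂ r₁ r₂ {h} r₂≤h h≤r₁+r₂ =
  trans (cong (_⊓ (r₁ + 2 * r₂)) (m≥n⇒m⊓n≡n h+r₂≤2h)) (m≤n⇒m⊓n≡m h+r₂≤r₁+2r₂)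
  where
  h+r₂≤2h : h + r₂ ≤ 2 * h
  h+r₂≤2h = begin
    h + r₂ ≤⟨ +-monoʳ-≤ h r₂≤h ⟩
    h + h  ≡⟨ solve (h ∷ []) ⟩
    2 * h  ∎
    where open ≤-Reasoning
  h+r₂≤r₁+2r₂ : h + r₂ ≤ r₁ + 2 * r₂
  h+r₂≤r₁+2r₂ = begin
    h + r₂        ≤⟨ +-monoˡ-≤ r₂ h≤r₁+r₂ ⟩
    r₁ + r₂ + r₂  ≡⟨ solve (r₁ ∷ r₂ ∷ []) ⟩
    r₁ + 2 * r₂   ∎
    where open ≤-Reasoning

maxWeight-≤r₂ : ∀ r₁ {r₂ h} → h ≤ r₂ → maxWeight r₁ r₂ h ≡ 2 * h
maxWeight-≤r₂ r₁ {r₂} {h} h≤r₂ =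
  trans (cong (_⊓ (r₁ + 2 * r₂)) (m≤n⇒m⊓n≡m 2h≤h+r₂)) (m≤n⇒m⊓n≡m 2h≤r₁+2r₂)
  where
  2h≤h+r₂ : 2 * h ≤ h + r₂
  2h≤h+r₂ = begin
    2 * h  ≡⟨ solve (h ∷ []) ⟩
    h + h  ≤⟨ +-monoʳ-≤ h h≤r₂ ⟩
    h + r₂ ∎
    where open ≤-Reasoning
  2h≤r₁+2r₂ : 2 * h ≤ r₁ + 2 * r₂
  2h≤r₁+2r₂ = ≤-trans (*-monoʳ-≤ 2 h≤r₂) (m≤n+m _ r₁)

minWeight-≥r₀+r₁ : ∀ r₀ r₁ {h} → r₀ + r₁ ≤ h → minWeight r₀ r₁ h ≡ r₁ + 2 * (h ∸ (r₀ + r₁))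
minWeight-≥r₀+r₁ r₀ r₁ r₀+r₁≤h with m≤n⇒∃[o]m+o≡n r₀+r₁≤h
... | e , refl rewrite m+n∸m≡n (r₀ + r₁) e = trans (cong₂ _⊔_ h∸r₀ 2h∸[2r₀+r₁]) (m≤n⇒m⊔n≡n r₁+e≤r₁+2e)
  where
  h∸r₀ : r₀ + r₁ + e ∸ r₀ ≡ r₁ + e
  h∸r₀ = trans (cong (_∸ r₀) (+-assoc r₀ r₁ e)) (m+n∸m≡n r₀ (r₁ + e))
  2h∸[2r₀+r₁] : 2 * (r₀ + r₁ + e) ∸ (2 * r₀ + r₁) ≡ r₁ + 2 * e
  2h∸[2r₀+r₁] = trans (cong (_∸ (2 * r₀ + r₁)) 2h≡) (m+n∸m≡n (2 * r₀ + r₁) (r₁ + 2 * e))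
    where
    2h≡ : 2 * (r₀ + r₁ + e) ≡ 2 * r₀ + r₁ + (r₁ + 2 * e)
    2h≡ = solve (r₀ ∷ r₁ ∷ e ∷ [])
  r₁+e≤r₁+2e : r₁ + e ≤ r₁ + 2 * e
  r₁+e≤r₁+2e = +-monoʳ-≤ r₁ (m≤m+n e (e + 0))

minWeight-≥r₀ : ∀ r₀ r₁ {h} → r₀ ≤ h → h ≤ r₀ + r₁ → minWeight r₀ r₁ h ≡ h ∸ r₀
minWeight-≥r₀ r₀ r₁ r₀≤h h≤r₀+r₁ with m≤n⇒∃[o]m+o≡n r₀≤h
... | e , refl rewrite m+n∸m≡n r₀ e = m≥n⇒m⊔n≡m (m≤n+o⇒m∸n≤o (2 * (r₀ + e)) (2 * r₀ + r₁) 2h≤)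
  where
  2h≤ : 2 * (r₀ + e) ≤ 2 * r₀ + r₁ + e
  2h≤ = begin
    2 * (r₀ + e)    ≡⟨ solve (r₀ ∷ e ∷ []) ⟩
    2 * r₀ + e + e  ≤⟨ +-monoˡ-≤ e (+-monoʳ-≤ (2 * r₀) (+-cancelˡ-≤ r₀ e r₁ h≤r₀+r₁)) ⟩
    2 * r₀ + r₁ + e ∎
    where open ≤-Reasoning

minWeight-≤r₀ : ∀ {r₀} r₁ {h} → h ≤ r₀ → minWeight r₀ r₁ h ≡ 0
minWeight-≤r₀ {r₀} r₁ {h} h≤r₀ = cong₂ _⊔_ (m≤n⇒m∸n≡0 h≤r₀) (m≤n⇒m∸n≡0 2h≤2r₀+r₁)
  where
  2h≤2r₀+r₁ : 2 * h ≤ 2 * r₀ + r₁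
  2h≤2r₀+r₁ = ≤-trans (*-monoʳ-≤ 2 h≤r₀) (m≤m+n _ r₁)

≤ᵇ-true : ∀ {m n} → m ≤ n → (m ≤ᵇ n) ≡ true
≤ᵇ-true m≤n = Equivalence.to T-≡ (≤⇒≤ᵇ m≤n)

≤ᵇ-false : ∀ {m n} → n < m → (m ≤ᵇ n) ≡ false
≤ᵇ-false {m} {n} n<m = ¬-not (λ m≤ᵇn → <⇒≱ n<m (≤ᵇ⇒≤ m n (Equivalence.from T-≡ m≤ᵇn)))

-- The two brackets of L; they are the largest and the least weight of a coefficient vector.
largestWeight leastWeight : ℕ → ℕ → ℕ → ℕ → ℤ
largestWeight r₀ r₁ r₂ h = + wsuffix r₀ r₁ r₂ (Mr r₀ r₁ r₂ h) ℤ.+ Mr r₀ r₁ r₂ h ℤ.* θr r₀ r₁ r₂ h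
leastWeight r₀ r₁ r₂ h = + wprefix r₀ r₁ r₂ (Ir r₀ r₁ r₂ h) ℤ.+ + Ir r₀ r₁ r₂ h ℤ.* δr r₀ r₁ r₂ h

L≡largest-least+1 : ∀ r₀ r₁ r₂ h → L r₀ r₁ r₂ h ≡ largestWeight r₀ r₁ r₂ h ℤ.- leastWeight r₀ r₁ r₂ h ℤ.+ + 1
L≡largest-least+1 r₀ r₁ r₂ h = regroup (+ wsuffix r₀ r₁ r₂ (Mr r₀ r₁ r₂ h)) (+ wprefix r₀ r₁ r₂ (Ir r₀ r₁ r₂ h))
  (Mr r₀ r₁ r₂ h ℤ.* θr r₀ r₁ r₂ h) (+ Ir r₀ r₁ r₂ h ℤ.* δr r₀ r₁ r₂ h)
  where
  regroup : ∀ a b c d → a ℤ.- b ℤ.+ c ℤ.- d ℤ.+ + 1 ≡ (a ℤ.+ c) ℤ.- (b ℤ.+ d) ℤ.+ + 1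
  regroup = ℤRing.solve-∀

+w+m*[h-s] : ∀ w m {s h} → s ≤ h → + w ℤ.+ + m ℤ.* (+ h ℤ.- + s) ≡ + (w + m * (h ∸ s))
+w+m*[h-s] w m {s} {h} s≤h = begin
  + w ℤ.+ + m ℤ.* (+ h ℤ.- + s) ≡⟨ cong (λ d → + w ℤ.+ + m ℤ.* d) (trans (ℤP.m-n≡m⊖n h s) (ℤP.⊖-≥ s≤h)) ⟩
  + w ℤ.+ + m ℤ.* + (h ∸ s)     ≡⟨ cong (λ d → + w ℤ.+ d) (sym (ℤP.pos-* m (h ∸ s))) ⟩
  + (w + m * (h ∸ s))           ∎
  where open ≡-Reasoning

largestWeight≡maxWeight : ∀ r₀ r₁ r₂ {h} → h < r₀ + r₁ + r₂ → largestWeight r₀ r₁ r₂ h ≡ + maxWeight r₁ r₂ h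
largestWeight≡maxWeight r₀ r₁ r₂ {h} h<r with r₁ + r₂ ≤? h | r₂ ≤? h
... | yes r₁+r₂≤h | _ rewrite ≤ᵇ-false h<r | ≤ᵇ-true r₁+r₂≤h =
  trans (+w+m*[h-s] (1 * r₁ + 2 * r₂) 0 r₁+r₂≤h)
        (cong +_ (trans (identity r₁ r₂ (h ∸ (r₁ + r₂))) (sym (maxWeight-≥r₁+r₂ r₁ r₂ r₁+r₂≤h))))
  where
  identity : ∀ a b k → 1 * a + 2 * b + 0 * k ≡ a + 2 * b
  identity = ℕRing.solve-∀
... | no r₁+r₂≰h | yes r₂≤h rewrite ≤ᵇ-false h<r | ≤ᵇ-false (≰⇒> r₁+r₂≰h) | ≤ᵇ-true r₂≤h =
  trans (+w+m*[h-s] (2 * r₂) 1 r₂≤h) (cong +_ (trans weight≡ (sym (maxWeight-≥r₂ r₁ r₂ r₂≤h (<⇒≤ (≰⇒> r₁+r₂≰h))))))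
  where
  identity : ∀ a k → 2 * a + 1 * k ≡ k + a + a
  identity = ℕRing.solve-∀
  weight≡ : 2 * r₂ + 1 * (h ∸ r₂) ≡ h + r₂
  weight≡ = trans (identity r₂ (h ∸ r₂)) (cong (_+ r₂) (m∸n+n≡m r₂≤h))
... | no r₁+r₂≰h | no r₂≰h rewrite ≤ᵇ-false h<r | ≤ᵇ-false (≰⇒> r₁+r₂≰h) | ≤ᵇ-false (≰⇒> r₂≰h) =
  trans (+w+m*[h-s] 0 2 {h = h} z≤n) (cong +_ (sym (maxWeight-≤r₂ r₁ (<⇒≤ (≰⇒> r₂≰h)))))

leastWeight≡minWeight : ∀ r₀ r₁ r₂ {h} → h < r₀ + r₁ + r₂ → leastWeight r₀ r₁ r₂ h ≡ + minWeight r₀ r₁ h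
leastWeight≡minWeight r₀ r₁ r₂ {h} h<r with r₀ + r₁ ≤? h | r₀ ≤? h
... | yes r₀+r₁≤h | _ rewrite ≤ᵇ-false h<r | ≤ᵇ-true r₀+r₁≤h =
  trans (+w+m*[h-s] (0 * r₀ + 1 * r₁) 2 r₀+r₁≤h)
        (cong +_ (trans (identity r₀ r₁ (h ∸ (r₀ + r₁))) (sym (minWeight-≥r₀+r₁ r₀ r₁ r₀+r₁≤h))))
  where
  identity : ∀ a b k → 0 * a + 1 * b + 2 * k ≡ b + 2 * k
  identity = ℕRing.solve-∀
... | no r₀+r₁≰h | yes r₀≤h rewrite ≤ᵇ-false h<r | ≤ᵇ-false (≰⇒> r₀+r₁≰h) | ≤ᵇ-true r₀≤h =
  trans (+w+m*[h-s] (0 * r₀) 1 r₀≤h) (cong +_ (trans (identity r₀ (h ∸ r₀)) (sym (minWeight-≥r₀ r₀ r₁ r₀≤h (<⇒≤ (≰⇒> r₀+r₁≰h))))))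
  where
  identity : ∀ a k → 0 * a + 1 * k ≡ k
  identity = ℕRing.solve-∀
... | no r₀+r₁≰h | no r₀≰h rewrite ≤ᵇ-false h<r | ≤ᵇ-false (≰⇒> r₀+r₁≰h) | ≤ᵇ-false (≰⇒> r₀≰h) =
  cong +_ (sym (minWeight-≤r₀ r₁ (<⇒≤ (≰⇒> r₀≰h))))

minWeight+L≡1+maxWeight : ∀ r₀ r₁ r₂ {h} → h < r₀ + r₁ + r₂ →
                          + minWeight r₀ r₁ h ℤ.+ L r₀ r₁ r₂ h ≡ + suc (maxWeight r₁ r₂ h)
minWeight+L≡1+maxWeight r₀ r₁ r₂ {h} h<r = begin
  + minWeight r₀ r₁ h ℤ.+ L r₀ r₁ r₂ h
    ≡⟨ cong₂ ℤ._+_ (sym (leastWeight≡minWeight r₀ r₁ r₂ h<r)) (L≡largest-least+1 r₀ r₁ r₂ h) ⟩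
  leastWeight r₀ r₁ r₂ h ℤ.+ (largestWeight r₀ r₁ r₂ h ℤ.- leastWeight r₀ r₁ r₂ h ℤ.+ + 1)
    ≡⟨ cancel (largestWeight r₀ r₁ r₂ h) (leastWeight r₀ r₁ r₂ h) ⟩
  + 1 ℤ.+ largestWeight r₀ r₁ r₂ h
    ≡⟨ cong (ℤ._+_ (+ 1)) (largestWeight≡maxWeight r₀ r₁ r₂ h<r) ⟩
  + suc (maxWeight r₁ r₂ h) ∎
  where
  open ≡-Reasoning
  cancel : ∀ a b → b ℤ.+ (a ℤ.- b ℤ.+ + 1) ≡ + 1 ℤ.+ a
  cancel = ℤRing.solve-∀

+2*-injective : ∀ {y z y′ z′} → y ≤ 1 → y′ ≤ 1 → y + 2 * z ≡ y′ + 2 * z′ → y ≡ y′ × z ≡ z′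
+2*-injective {y} {z} {y′} {z′} y≤1 y′≤1 eq = y≡y′ , *-cancelˡ-≡ z z′ 2 (+-cancelˡ-≡ y (2 * z) (2 * z′) (trans eq (cong (_+ 2 * z′) (sym y≡y′))))
  where
  parity : ∀ {u} v → u ≤ 1 → (u + 2 * v) % 2 ≡ u
  parity {u} v u≤1 = trans (cong (λ w → (u + w) % 2) (*-comm 2 v)) (trans ([m+kn]%n≡m%n u v 2) (m<n⇒m%n≡m (s≤s u≤1)))
  y≡y′ : y ≡ y′
  y≡y′ = trans (sym (parity z y≤1)) (trans (cong (_% 2) eq) (parity z′ y′≤1))

distribute : ∀ {c₀ c₁ c₂ n} → n ≤ c₀ + c₁ + c₂ →
             ∃[ x ] ∃[ y ] ∃[ z ] x ≤ c₀ × y ≤ c₁ × z ≤ c₂ × x + y + z ≡ n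
distribute {c₀} {c₁} {c₂} {n} n≤c with n ≤? c₀
... | yes n≤c₀ = n , 0 , 0 , n≤c₀ , z≤n , z≤n , trans (+-identityʳ (n + 0)) (+-identityʳ n)
... | no n≰c₀ with m≤n⇒∃[o]m+o≡n (<⇒≤ (≰⇒> n≰c₀))
...   | e , refl with e ≤? c₁
...     | yes e≤c₁ = c₀ , e , 0 , ≤-refl , e≤c₁ , z≤n , +-identityʳ (c₀ + e)
...     | no e≰c₁ with m≤n⇒∃[o]m+o≡n (<⇒≤ (≰⇒> e≰c₁))
...       | f , refl = c₀ , c₁ , f , ≤-refl , ≤-refl , f≤c₂ , +-assoc c₀ c₁ f
  where
  f≤c₂ : f ≤ c₂
  f≤c₂ = +-cancelˡ-≤ (c₀ + c₁) f c₂ (subst (_≤ c₀ + c₁ + c₂) (sym (+-assoc c₀ c₁ f)) n≤c)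

diamond-corner : ∀ {r₀ r₁ r₂ h} → 1 ≤ r₀ → 2 ≤ r₁ → 1 ≤ r₂ → 2 ≤ h → h + 2 ≤ r₀ + r₁ + r₂ →
                 ∃[ x ] ∃[ y ] ∃[ z ] suc x ≤ r₀ × suc (suc y) ≤ r₁ × suc z ≤ r₂ × suc x + suc y + z ≡ h
diamond-corner {suc r₀} {suc (suc r₁)} {suc r₂} {suc (suc h)} (s≤s _) (s≤s (s≤s _)) (s≤s _) (s≤s (s≤s _)) h+2≤r
  with distribute {r₀} {r₁} {r₂} {h} (+-cancelˡ-≤ 4 h (r₀ + r₁ + r₂) (subst₂ _≤_ (h+4 h) (r+4 r₀ r₁ r₂) h+2≤r))
  where
  h+4 : ∀ h → suc (suc h) + 2 ≡ 4 + h
  h+4 = ℕRing.solve-∀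
  r+4 : ∀ r₀ r₁ r₂ → suc r₀ + suc (suc r₁) + suc r₂ ≡ 4 + (r₀ + r₁ + r₂)
  r+4 = ℕRing.solve-∀
... | x , y , z , x≤r₀ , y≤r₁ , z≤r₂ , sum = x , y , z , s≤s x≤r₀ , s≤s (s≤s y≤r₁) , s≤s z≤r₂ , cong suc (trans (shift x y z) (cong suc sum))
  where
  shift : ∀ x y z → x + suc y + z ≡ suc (x + y + z)
  shift = ℕRing.solve-∀

-- The restricted sumset

module RestrictedSumset (r₀ r₁ r₂ h : ℕ) (a₀ a₁ a₂ : ℤ) where

  record Coeff : Set where
    constructor coeff
    field
      s₀ s₁ s₂ : ℕ
      s₀≤r₀ : s₀ ≤ r₀
      s₁≤r₁ : s₁ ≤ r₁
      s₂≤r₂ : s₂ ≤ r₂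
      sum≡h : s₀ + s₁ + s₂ ≡ h

  open Coeff

  weight : Coeff → ℕ
  weight s = s₁ s + 2 * s₂ s

  combination : ℕ → ℕ → ℕ → ℤ
  combination x y z = + x ℤ.* a₀ ℤ.+ + y ℤ.* a₁ ℤ.+ + z ℤ.* a₂

  value : Coeff → ℤ
  value s = combination (s₀ s) (s₁ s) (s₂ s)

  some-coeff : h ≤ r₀ + r₁ + r₂ → Coeff
  some-coeff h≤r with distribute h≤r
  ... | x , y , z , x≤r₀ , y≤r₁ , z≤r₂ , sum = coeff x y z x≤r₀ y≤r₁ z≤r₂ sum

  weight≤maxWeight : ∀ s → weight s ≤ maxWeight r₁ r₂ h
  weight≤maxWeight s = subst (λ n → weight s ≤ maxWeight r₁ r₂ n) (sum≡h s) (y+2*z≤maxWeight (s₀ s) (s₁≤r₁ s) (s₂≤r₂ s))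

  minWeight≤weight : ∀ s → minWeight r₀ r₁ h ≤ weight s
  minWeight≤weight s = subst (λ n → minWeight r₀ r₁ n ≤ weight s) (sum≡h s) (minWeight≤y+2*z (s₂ s) (s₀≤r₀ s) (s₁≤r₁ s))

  S : List ℤ
  S = sumList r₀ r₁ r₂ h a₀ a₁ a₂

  ∈-if-≟⁺ : ∀ {m n} (w : ℤ) → m ≡ n → w ∈ (if ⌊ m ℕ.≟ n ⌋ then [ w ] else [])
  ∈-if-≟⁺ {m} {n} w m≡n with m ℕ.≟ n
  ... | yes _ = here refl
  ... | no m≢n = ⊥-elim (m≢n m≡n)

  ∈-if-≟⁻ : ∀ {m n} {v w : ℤ} → v ∈ (if ⌊ m ℕ.≟ n ⌋ then [ w ] else []) → m ≡ n × v ≡ w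
  ∈-if-≟⁻ {m} {n} v∈ with m ℕ.≟ n
  ∈-if-≟⁻ (here v≡w) | yes m≡n = m≡n , v≡w
  ∈-if-≟⁻ () | no _

  value∈S : ∀ s → value s ∈ S
  value∈S (coeff x y z x≤r₀ y≤r₁ z≤r₂ sum) =
    ∈.∈-concatMap⁺ _ (lose (∈.∈-upTo⁺ (s≤s x≤r₀))
      (∈.∈-concatMap⁺ _ (lose (∈.∈-upTo⁺ (s≤s y≤r₁))
        (∈.∈-concatMap⁺ _ (lose (∈.∈-upTo⁺ (s≤s z≤r₂)) (∈-if-≟⁺ (combination x y z) sum))))))

  ∈S⇒value : ∀ {v} → v ∈ S → Σ[ s ∈ Coeff ] v ≡ value s
  ∈S⇒value v∈S with find (∈.∈-concatMap⁻ _ v∈S)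
  ... | x , x∈ , v∈₀ with find (∈.∈-concatMap⁻ _ v∈₀)
  ... | y , y∈ , v∈₁ with find (∈.∈-concatMap⁻ _ v∈₁)
  ... | z , z∈ , v∈₂ with ∈-if-≟⁻ v∈₂
  ... | sum , v≡ = coeff x y z (≤-pred (∈.∈-upTo⁻ x∈)) (≤-pred (∈.∈-upTo⁻ y∈)) (≤-pred (∈.∈-upTo⁻ z∈)) sum , v≡

  card : ℕ
  card = sumsetCard r₀ r₁ r₂ h a₀ a₁ a₂

  Unique⇒length≤card : ∀ {xs} → Unique xs → xs ⊆ S → length xs ≤ card
  Unique⇒length≤card u xs⊆S = Unique-⊆⇒length≤ u (∈.∈-deduplicate⁺ ℤ._≟_ ∘ xs⊆S)

  card≤length : ∀ {xs} → S ⊆ xs → card ≤ length xs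
  card≤length S⊆xs = Unique-⊆⇒length≤ (deduplicate-! S) (S⊆xs ∘ ∈.∈-deduplicate⁻ ℤ._≟_ S)

  ValueDeterminedByWeight : Set
  ValueDeterminedByWeight = ∀ s t → weight s ≡ weight t → value s ≡ value t

  r₁≡1⇒determined : r₁ ≡ 1 → ValueDeterminedByWeight
  r₁≡1⇒determined refl (coeff x y z _ y≤1 _ sum) (coeff x′ y′ z′ _ y′≤1 _ sum′) w≡w′
    with +2*-injective {y} {z} {y′} {z′} y≤1 y′≤1 w≡w′
  ... | refl , refl = cong (λ x → combination x y z) (+-cancelʳ-≡ y x x′ (+-cancelʳ-≡ z (x + y) (x′ + y) (trans sum (sym sum′))))

  value-AP : IsAP3 a₀ a₁ a₂ → ∀ s → value s ≡ + h ℤ.* a₀ ℤ.+ + weight s ℤ.* (a₁ ℤ.- a₀)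
  value-AP ap (coeff x y z _ _ _ sum) = begin
    combination x y z
      ≡⟨ expand (+ x) (+ y) (+ z) a₀ a₁ a₂ ⟩
    + (x + y + z) ℤ.* a₀ ℤ.+ + (y + 2 * z) ℤ.* (a₁ ℤ.- a₀) ℤ.+ + z ℤ.* ((a₂ ℤ.- a₁) ℤ.- (a₁ ℤ.- a₀))
      ≡⟨ cong (λ d → + (x + y + z) ℤ.* a₀ ℤ.+ + (y + 2 * z) ℤ.* (a₁ ℤ.- a₀) ℤ.+ + z ℤ.* (d ℤ.- (a₁ ℤ.- a₀))) (sym ap) ⟩
    + (x + y + z) ℤ.* a₀ ℤ.+ + (y + 2 * z) ℤ.* (a₁ ℤ.- a₀) ℤ.+ + z ℤ.* ((a₁ ℤ.- a₀) ℤ.- (a₁ ℤ.- a₀))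
      ≡⟨ cancel (+ (x + y + z) ℤ.* a₀ ℤ.+ + (y + 2 * z) ℤ.* (a₁ ℤ.- a₀)) (+ z) (a₁ ℤ.- a₀) ⟩
    + (x + y + z) ℤ.* a₀ ℤ.+ + (y + 2 * z) ℤ.* (a₁ ℤ.- a₀)
      ≡⟨ cong (λ n → + n ℤ.* a₀ ℤ.+ + (y + 2 * z) ℤ.* (a₁ ℤ.- a₀)) sum ⟩
    + h ℤ.* a₀ ℤ.+ + (y + 2 * z) ℤ.* (a₁ ℤ.- a₀) ∎
    where
    open ≡-Reasoning
    -- Y + (Z + (Z + + 0)) at + y, + z is + (y + 2 * z) unfolded, as used in the next step.
    expand : ∀ X Y Z A₀ A₁ A₂ → X ℤ.* A₀ ℤ.+ Y ℤ.* A₁ ℤ.+ Z ℤ.* A₂ ≡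
      (X ℤ.+ Y ℤ.+ Z) ℤ.* A₀ ℤ.+ (Y ℤ.+ (Z ℤ.+ (Z ℤ.+ + 0))) ℤ.* (A₁ ℤ.- A₀) ℤ.+ Z ℤ.* ((A₂ ℤ.- A₁) ℤ.- (A₁ ℤ.- A₀))
    expand = ℤRing.solve-∀
    cancel : ∀ U Z D → U ℤ.+ Z ℤ.* (D ℤ.- D) ≡ U
    cancel = ℤRing.solve-∀

  AP⇒determined : IsAP3 a₀ a₁ a₂ → ValueDeterminedByWeight
  AP⇒determined ap s t w≡w′ = begin
    value s                                        ≡⟨ value-AP ap s ⟩
    + h ℤ.* a₀ ℤ.+ + weight s ℤ.* (a₁ ℤ.- a₀)      ≡⟨ cong (λ w → + h ℤ.* a₀ ℤ.+ + w ℤ.* (a₁ ℤ.- a₀)) w≡w′ ⟩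
    + h ℤ.* a₀ ℤ.+ + weight t ℤ.* (a₁ ℤ.- a₀)      ≡⟨ sym (value-AP ap t) ⟩
    value t                                        ∎
    where open ≡-Reasoning

  exchange⇒IsAP3 : ∀ x y z → combination x (suc (suc y)) z ≡ combination (suc x) y (suc z) → IsAP3 a₀ a₁ a₂
  exchange⇒IsAP3 x y z eq = ℤP.i-j≡0⇒i≡j _ _ (begin
    (a₁ ℤ.- a₀) ℤ.- (a₂ ℤ.- a₁)                                       ≡⟨ difference (+ x) (+ y) (+ z) a₀ a₁ a₂ ⟨
    combination x (suc (suc y)) z ℤ.- combination (suc x) y (suc z)  ≡⟨ cong (λ c → c ℤ.- combination (suc x) y (suc z)) eq ⟩
    combination (suc x) y (suc z) ℤ.- combination (suc x) y (suc z)  ≡⟨ ℤP.+-inverseʳ (combination (suc x) y (suc z)) ⟩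
    + 0                                                              ∎)
    where
    open ≡-Reasoning
    difference : ∀ X Y Z A₀ A₁ A₂ → (X ℤ.* A₀ ℤ.+ (+ 2 ℤ.+ Y) ℤ.* A₁ ℤ.+ Z ℤ.* A₂) ℤ.- ((+ 1 ℤ.+ X) ℤ.* A₀ ℤ.+ Y ℤ.* A₁ ℤ.+ (+ 1 ℤ.+ Z) ℤ.* A₂)
                                  ≡ (A₁ ℤ.- A₀) ℤ.- (A₂ ℤ.- A₁)
    difference = ℤRing.solve-∀

  module Chains (a₀<a₁ : a₀ ℤ.< a₁) (a₁<a₂ : a₁ ℤ.< a₂) (1≤r₁ : 1 ≤ r₁) where

    combination-shift₀₁ : ∀ x y z → combination (suc x) y z ℤ.< combination x (suc y) z
    combination-shift₀₁ x y z =
      subst₂ ℤ._<_ (sym (add₀ (+ x) (+ y) (+ z) a₀ a₁ a₂)) (sym (add₁ (+ x) (+ y) (+ z) a₀ a₁ a₂))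
             (ℤP.+-monoˡ-< (combination x y z) a₀<a₁)
      where
      add₀ : ∀ X Y Z A₀ A₁ A₂ → (+ 1 ℤ.+ X) ℤ.* A₀ ℤ.+ Y ℤ.* A₁ ℤ.+ Z ℤ.* A₂ ≡ A₀ ℤ.+ (X ℤ.* A₀ ℤ.+ Y ℤ.* A₁ ℤ.+ Z ℤ.* A₂)
      add₀ = ℤRing.solve-∀
      add₁ : ∀ X Y Z A₀ A₁ A₂ → X ℤ.* A₀ ℤ.+ (+ 1 ℤ.+ Y) ℤ.* A₁ ℤ.+ Z ℤ.* A₂ ≡ A₁ ℤ.+ (X ℤ.* A₀ ℤ.+ Y ℤ.* A₁ ℤ.+ Z ℤ.* A₂)
      add₁ = ℤRing.solve-∀

    combination-shift₁₂ : ∀ x y z → combination x (suc y) z ℤ.< combination x y (suc z)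
    combination-shift₁₂ x y z =
      subst₂ ℤ._<_ (sym (add₁ (+ x) (+ y) (+ z) a₀ a₁ a₂)) (sym (add₂ (+ x) (+ y) (+ z) a₀ a₁ a₂))
             (ℤP.+-monoˡ-< (combination x y z) a₁<a₂)
      where
      add₁ : ∀ X Y Z A₀ A₁ A₂ → X ℤ.* A₀ ℤ.+ (+ 1 ℤ.+ Y) ℤ.* A₁ ℤ.+ Z ℤ.* A₂ ≡ A₁ ℤ.+ (X ℤ.* A₀ ℤ.+ Y ℤ.* A₁ ℤ.+ Z ℤ.* A₂)
      add₁ = ℤRing.solve-∀
      add₂ : ∀ X Y Z A₀ A₁ A₂ → X ℤ.* A₀ ℤ.+ Y ℤ.* A₁ ℤ.+ (+ 1 ℤ.+ Z) ℤ.* A₂ ≡ A₂ ℤ.+ (X ℤ.* A₀ ℤ.+ Y ℤ.* A₁ ℤ.+ Z ℤ.* A₂)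
      add₂ = ℤRing.solve-∀

    Up Down : Coeff → Set
    Up s = Σ[ t ∈ Coeff ] weight t ≡ suc (weight s) × value s ℤ.< value t
    Down s = Σ[ t ∈ Coeff ] suc (weight t) ≡ weight s × value t ℤ.< value s

    shift-sum : ∀ x y z → x + y + suc z ≡ x + suc y + z
    shift-sum = ℕRing.solve-∀

    shift-weight : ∀ y z → y + 2 * suc z ≡ suc (suc y + 2 * z)
    shift-weight = ℕRing.solve-∀

    shift₀₁ : ∀ s → Up s ⊎ (s₀ s ≡ 0 ⊎ r₁ ≤ s₁ s)
    shift₀₁ (coeff zero _ _ _ _ _ _) = inj₂ (inj₁ refl)
    shift₀₁ (coeff (suc x) y z x<r₀ _ z≤r₂ sum) with suc y ≤? r₁
    ... | yes y<r₁ = inj₁ (coeff x (suc y) z (<⇒≤ x<r₀) y<r₁ z≤r₂ (trans (cong (_+ z) (+-suc x y)) sum) ,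
                           refl , combination-shift₀₁ x y z)
    ... | no y≮r₁ = inj₂ (inj₂ (≮⇒≥ y≮r₁))

    shift₁₂ : ∀ s → Up s ⊎ (s₁ s ≡ 0 ⊎ r₂ ≤ s₂ s)
    shift₁₂ (coeff _ zero _ _ _ _ _) = inj₂ (inj₁ refl)
    shift₁₂ (coeff x (suc y) z x≤r₀ y<r₁ _ sum) with suc z ≤? r₂
    ... | yes z<r₂ = inj₁ (coeff x y (suc z) x≤r₀ (<⇒≤ y<r₁) z<r₂ (trans (shift-sum x y z) sum) ,
                           shift-weight y z , combination-shift₁₂ x y z)
    ... | no z≮r₂ = inj₂ (inj₂ (≮⇒≥ z≮r₂))

    unshift₀₁ : ∀ s → Down s ⊎ (s₁ s ≡ 0 ⊎ r₀ ≤ s₀ s)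
    unshift₀₁ (coeff _ zero _ _ _ _ _) = inj₂ (inj₁ refl)
    unshift₀₁ (coeff x (suc y) z _ y<r₁ z≤r₂ sum) with suc x ≤? r₀
    ... | yes x<r₀ = inj₁ (coeff (suc x) y z x<r₀ (<⇒≤ y<r₁) z≤r₂ (trans (cong (_+ z) (sym (+-suc x y))) sum) ,
                           refl , combination-shift₀₁ x y z)
    ... | no x≮r₀ = inj₂ (inj₂ (≮⇒≥ x≮r₀))

    unshift₁₂ : ∀ s → Down s ⊎ (s₂ s ≡ 0 ⊎ r₁ ≤ s₁ s)
    unshift₁₂ (coeff _ _ zero _ _ _ _) = inj₂ (inj₁ refl)
    unshift₁₂ (coeff x y (suc z) x≤r₀ _ z<r₂ sum) with suc y ≤? r₁
    ... | yes y<r₁ = inj₁ (coeff x (suc y) z x≤r₀ y<r₁ (<⇒≤ z<r₂) (trans (sym (shift-sum x y z)) sum) ,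
                           sym (shift-weight y z) , combination-shift₁₂ x y z)
    ... | no y≮r₁ = inj₂ (inj₂ (≮⇒≥ y≮r₁))

    step-up : ∀ s → weight s < maxWeight r₁ r₂ h → Up s
    step-up s w<max with shift₀₁ s | shift₁₂ s
    ... | inj₁ up | _ = up
    ... | inj₂ _ | inj₁ up = up
    ... | inj₂ stuck₀₁ | inj₂ stuck₁₂ =
      ⊥-elim (<⇒≱ w<max (subst (λ n → maxWeight r₁ r₂ n ≤ weight s) (sum≡h s) (maxWeight≤y+2*z 1≤r₁ stuck₀₁ stuck₁₂)))

    step-down : ∀ s → minWeight r₀ r₁ h < weight s → Down s
    step-down s min<w with unshift₀₁ s | unshift₁₂ s
    ... | inj₁ down | _ = down
    ... | inj₂ _ | inj₁ down = down
    ... | inj₂ stuck₀₁ | inj₂ stuck₁₂ =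
      ⊥-elim (<⇒≱ min<w (subst (λ n → weight s ≤ minWeight r₀ r₁ n) (sum≡h s) (y+2*z≤minWeight 1≤r₁ stuck₀₁ stuck₁₂)))

    toTop toBottom : Coeff → ℕ
    toTop s = maxWeight r₁ r₂ h ∸ weight s
    toBottom s = weight s ∸ minWeight r₀ r₁ h

    ascent : ∀ s → Walk ℤ._<_ toTop value s
    ascent = walk step
      where
      step : ∀ s {n} → toTop s ≡ suc n → Σ[ t ∈ Coeff ] toTop t ≡ n × value s ℤ.< value t
      step s {n} toTop≡1+n with step-up s (m∸n≢0⇒n<m (λ toTop≡0 → 1+n≢0 (trans (sym toTop≡1+n) toTop≡0)))
      ... | t , wt≡1+ws , s<t = t , toTop≡n , s<t
        where
        toTop≡n : toTop t ≡ n
        toTop≡n = begin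
          maxWeight r₁ r₂ h ∸ weight t       ≡⟨ cong (maxWeight r₁ r₂ h ∸_) wt≡1+ws ⟩
          maxWeight r₁ r₂ h ∸ suc (weight s) ≡⟨ sym (pred[m∸n]≡m∸[1+n] _ (weight s)) ⟩
          pred (toTop s)                     ≡⟨ cong pred toTop≡1+n ⟩
          n                                  ∎
          where open ≡-Reasoning

    descent : ∀ s → Walk ℤ._>_ toBottom value s
    descent = walk step
      where
      step : ∀ s {n} → toBottom s ≡ suc n → Σ[ t ∈ Coeff ] toBottom t ≡ n × value s ℤ.> value t
      step s {n} toBottom≡1+n with step-down s (m∸n≢0⇒n<m (λ toBottom≡0 → 1+n≢0 (trans (sym toBottom≡1+n) toBottom≡0)))
      ... | t , 1+wt≡ws , t<s = t , suc-injective 1+toBottom≡1+n , t<s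
        where
        1+toBottom≡1+n : suc (toBottom t) ≡ suc n
        1+toBottom≡1+n = begin
          suc (toBottom t)                        ≡⟨ sym (+-∸-assoc 1 (minWeight≤weight t)) ⟩
          suc (weight t) ∸ minWeight r₀ r₁ h      ≡⟨ cong (_∸ minWeight r₀ r₁ h) 1+wt≡ws ⟩
          toBottom s                              ≡⟨ toBottom≡1+n ⟩
          suc n                                   ∎
          where open ≡-Reasoning

    open Walk

    values⊆S : ∀ ss → map value ss ⊆ S
    values⊆S ss v∈ with ∈.∈-map⁻ value v∈
    ... | s , _ , refl = value∈S s

    valley : Coeff → List ℤ
    valley p = map value (p ∷ path (descent p)) ++ map value (path (ascent p))

    length-valley : ∀ p → length (valley p) ≡ suc (toBottom p + toTop p)
    length-valley p = begin
      length (valley p)                                                      ≡⟨ length-++ (map value (p ∷ path (descent p))) ⟩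
      suc (length (map value (path (descent p))) + length (map value (path (ascent p))))
        ≡⟨ cong₂ (λ m n → suc (m + n)) (trans (length-map value (path (descent p))) (length-path (descent p)))
                                               (trans (length-map value (path (ascent p))) (length-path (ascent p))) ⟩
      suc (toBottom p + toTop p) ∎
      where open ≡-Reasoning

    minWeight+toBottom : ∀ p → minWeight r₀ r₁ h + toBottom p ≡ weight p
    minWeight+toBottom p = m+[n∸m]≡n (minWeight≤weight p)

    weight+toTop : ∀ p → weight p + toTop p ≡ maxWeight r₁ r₂ h
    weight+toTop p = m+[n∸m]≡n (weight≤maxWeight p)

    minWeight+length-valley : ∀ p → minWeight r₀ r₁ h + length (valley p) ≡ suc (maxWeight r₁ r₂ h)
    minWeight+length-valley p = begin
      minWeight r₀ r₁ h + length (valley p)            ≡⟨ cong (_+_ (minWeight r₀ r₁ h)) (length-valley p) ⟩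
      minWeight r₀ r₁ h + suc (toBottom p + toTop p)   ≡⟨ +-suc _ _ ⟩
      suc (minWeight r₀ r₁ h + (toBottom p + toTop p)) ≡⟨ cong suc (sym (+-assoc _ (toBottom p) (toTop p))) ⟩
      suc (minWeight r₀ r₁ h + toBottom p + toTop p)   ≡⟨ cong (λ w → suc (w + toTop p)) (minWeight+toBottom p) ⟩
      suc (weight p + toTop p)                         ≡⟨ cong suc (weight+toTop p) ⟩
      suc (maxWeight r₁ r₂ h)                          ∎
      where open ≡-Reasoning

    value∈map-value : ValueDeterminedByWeight → ∀ {t} {μ : Coeff → ℕ} {qs} →
                      (∀ q → μ q ≡ μ t → weight q ≡ weight t) →
                      Any (λ q → μ q ≡ μ t) qs → value t ∈ map value qs
    value∈map-value determined {t} μ-injective =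
      Any.map⁺ ∘ Any.map (λ {q} μq≡μt → determined t q (sym (μ-injective q μq≡μt)))

    value∈valley : ValueDeterminedByWeight → ∀ p t → value t ∈ valley p
    value∈valley determined p t with ≤-total (weight t) (weight p)
    ... | inj₁ wt≤wp = ∈.∈-++⁺ˡ {ys = map value (path (ascent p))}
      (value∈map-value determined {t} {toBottom} toBottom-injective (visits (descent p) (∸-monoˡ-≤ (minWeight r₀ r₁ h) wt≤wp)))
      where
      toBottom-injective : ∀ q → toBottom q ≡ toBottom t → weight q ≡ weight t
      toBottom-injective q = ∸-cancelʳ-≡ (minWeight≤weight q) (minWeight≤weight t)
    ... | inj₂ wp≤wt
      with value∈map-value determined {t} {toTop} toTop-injective (visits (ascent p) (∸-monoʳ-≤ (maxWeight r₁ r₂ h) wp≤wt))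
      where
      toTop-injective : ∀ q → toTop q ≡ toTop t → weight q ≡ weight t
      toTop-injective q = ∸-cancelˡ-≡ (weight≤maxWeight q) (weight≤maxWeight t)
    ...   | here t≡p = here t≡p
    ...   | there v∈ = ∈.∈-++⁺ʳ (map value (p ∷ path (descent p))) v∈

    S⊆valley : ValueDeterminedByWeight → ∀ p → S ⊆ valley p
    S⊆valley determined p v∈S = let t , v≡t = ∈S⇒value v∈S in subst (_∈ valley p) (sym v≡t) (value∈valley determined p t)

    maxWeight<minWeight+card : Coeff → maxWeight r₁ r₂ h < minWeight r₀ r₁ h + card
    maxWeight<minWeight+card p = begin-strict
      maxWeight r₁ r₂ h                      <⟨ n<1+n _ ⟩
      suc (maxWeight r₁ r₂ h)                ≡⟨ sym (minWeight+length-valley p) ⟩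
      minWeight r₀ r₁ h + length (valley p)  ≤⟨ +-monoʳ-≤ (minWeight r₀ r₁ h) (Unique⇒length≤card (valley-Unique (linked (descent p)) (linked (ascent p))) valley⊆S) ⟩
      minWeight r₀ r₁ h + card               ∎
      where
      open ≤-Reasoning
      valley⊆S : valley p ⊆ S
      valley⊆S = ⊆-++ (values⊆S (p ∷ path (descent p))) (values⊆S (path (ascent p)))

    minWeight+card≡1+maxWeight : ValueDeterminedByWeight → Coeff → minWeight r₀ r₁ h + card ≡ suc (maxWeight r₁ r₂ h)
    minWeight+card≡1+maxWeight determined p = ≤-antisym card-bound (maxWeight<minWeight+card p)
      where
      card-bound : minWeight r₀ r₁ h + card ≤ suc (maxWeight r₁ r₂ h)
      card-bound = subst (minWeight r₀ r₁ h + card ≤_) (minWeight+length-valley p)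
                         (+-monoʳ-≤ (minWeight r₀ r₁ h) (card≤length (S⊆valley determined p)))

    two-between⇒2+maxWeight≤minWeight+card :
      ∀ p q {m₁ m₂} → weight q ≡ 2 + weight p → value p ℤ.< m₁ → m₁ ℤ.< m₂ → m₂ ℤ.< value q → m₁ ∈ S → m₂ ∈ S →
      2 + maxWeight r₁ r₂ h ≤ minWeight r₀ r₁ h + card
    two-between⇒2+maxWeight≤minWeight+card p q {m₁} {m₂} wq≡2+wp p<m₁ m₁<m₂ m₂<q m₁∈S m₂∈S = begin
      2 + maxWeight r₁ r₂ h                  ≡⟨ cong (_+_ 2) (sym (weight+toTop q)) ⟩
      2 + (weight q + toTop q)               ≡⟨ cong (λ w → 2 + (w + toTop q)) wq≡2+wp ⟩
      2 + (2 + weight p + toTop q)           ≡⟨ cong (λ w → 2 + (2 + w + toTop q)) (sym (minWeight+toBottom p)) ⟩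
      2 + (2 + (minWeight r₀ r₁ h + toBottom p) + toTop q)
        ≡⟨ rearrange (minWeight r₀ r₁ h) (toBottom p) (toTop q) ⟩
      minWeight r₀ r₁ h + suc (toBottom p + suc (suc (suc (toTop q))))
        ≡⟨ cong (_+_ (minWeight r₀ r₁ h)) (sym length-chain) ⟩
      minWeight r₀ r₁ h + length chain       ≤⟨ +-monoʳ-≤ (minWeight r₀ r₁ h) (Unique⇒length≤card chain-Unique chain⊆S) ⟩
      minWeight r₀ r₁ h + card               ∎
      where
      open ≤-Reasoning
      rearrange : ∀ m b t → 2 + (2 + (m + b) + t) ≡ m + suc (b + suc (suc (suc t)))
      rearrange = ℕRing.solve-∀
      ups : List ℤ
      ups = m₁ ∷ m₂ ∷ map value (q ∷ path (ascent q))
      chain : List ℤ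
      chain = map value (p ∷ path (descent p)) ++ ups
      chain-Unique : Unique chain
      chain-Unique = valley-Unique (linked (descent p)) (p<m₁ Linked.∷ m₁<m₂ Linked.∷ m₂<q Linked.∷ linked (ascent q))
      ups⊆S : ups ⊆ S
      ups⊆S (here refl) = m₁∈S
      ups⊆S (there (here refl)) = m₂∈S
      ups⊆S (there (there v∈)) = values⊆S (q ∷ path (ascent q)) v∈
      chain⊆S : chain ⊆ S
      chain⊆S = ⊆-++ (values⊆S (p ∷ path (descent p))) ups⊆S
      length-chain : length chain ≡ suc (toBottom p + suc (suc (suc (toTop q))))
      length-chain = begin-equality
        length chain  ≡⟨ length-++ (map value (p ∷ path (descent p))) ⟩
        suc (length (map value (path (descent p))) + suc (suc (suc (length (map value (path (ascent q)))))))
          ≡⟨ cong₂ (λ m n → suc (m + suc (suc (suc n))))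
                   (trans (length-map value (path (descent p))) (length-path (descent p)))
                   (trans (length-map value (path (ascent q))) (length-path (ascent q))) ⟩
        suc (toBottom p + suc (suc (suc (toTop q)))) ∎

    ¬IsAP3⇒2+maxWeight≤minWeight+card :
      ¬ IsAP3 a₀ a₁ a₂ → ∀ {x y z} → suc x ≤ r₀ → suc (suc y) ≤ r₁ → suc z ≤ r₂ → suc x + suc y + z ≡ h →
      2 + maxWeight r₁ r₂ h ≤ minWeight r₀ r₁ h + card
    ¬IsAP3⇒2+maxWeight≤minWeight+card ¬ap {x} {y} {z} x<r₀ y+1<r₁ z<r₂ sum = diamond (ℤP.<-cmp (value Q₁) (value Q₂))
      where
      sum₁ : x + suc (suc y) + z ≡ h
      sum₁ = trans (cong (_+ z) (+-suc x (suc y))) sum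
      P Q₁ Q₂ R : Coeff
      P = coeff (suc x) (suc y) z x<r₀ (<⇒≤ y+1<r₁) (<⇒≤ z<r₂) sum
      Q₁ = coeff x (suc (suc y)) z (<⇒≤ x<r₀) y+1<r₁ (<⇒≤ z<r₂) sum₁
      Q₂ = coeff (suc x) y (suc z) x<r₀ (≤-trans (m≤n+m y 2) y+1<r₁) z<r₂ (trans (shift-sum (suc x) y z) sum)
      R = coeff x (suc y) (suc z) (<⇒≤ x<r₀) (<⇒≤ y+1<r₁) z<r₂ (trans (shift-sum x (suc y) z) sum₁)
      diamond : Tri (value Q₁ ℤ.< value Q₂) (value Q₁ ≡ value Q₂) (value Q₂ ℤ.< value Q₁) →
                2 + maxWeight r₁ r₂ h ≤ minWeight r₀ r₁ h + card
      diamond (tri< q₁<q₂ _ _) = two-between⇒2+maxWeight≤minWeight+card P R (shift-weight (suc y) z)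
        (combination-shift₀₁ x (suc y) z) q₁<q₂ (combination-shift₀₁ x y (suc z)) (value∈S Q₁) (value∈S Q₂)
      diamond (tri≈ _ q₁≡q₂ _) = ⊥-elim (¬ap (exchange⇒IsAP3 x y z q₁≡q₂))
      diamond (tri> _ _ q₂<q₁) = two-between⇒2+maxWeight≤minWeight+card P R (shift-weight (suc y) z)
        (combination-shift₁₂ (suc x) y z) q₂<q₁ (combination-shift₁₂ x (suc y) z) (value∈S Q₂) (value∈S Q₁)


theorem3 : (a0 a1 a2 : ℤ) → a0 ℤ.< a1 → a1 ℤ.< a2 →
    (r0 r1 r2 : ℕ) → 1 ℕ.≤ r0 → 1 ℕ.≤ r1 → 1 ℕ.≤ r2 →
    (h : ℕ) → 2 ℕ.≤ h → h ℕ.+ 2 ℕ.≤ r0 ℕ.+ r1 ℕ.+ r2 →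
    (r1 ≡ 1 → + sumsetCard r0 r1 r2 h a0 a1 a2 ≡ L r0 r1 r2 h)
    × (2 ℕ.≤ r1 → ((+ sumsetCard r0 r1 r2 h a0 a1 a2 ≡ L r0 r1 r2 h) ⇔ IsAP3 a0 a1 a2))
theorem3 a0 a1 a2 a0<a1 a1<a2 r0 r1 r2 1≤r0 1≤r1 1≤r2 h 2≤h h+2≤r = part-i , part-ii
  where
  open RestrictedSumset r0 r1 r2 h a0 a1 a2
  open Chains a0<a1 a1<a2 1≤r1
  h<r : h < r0 + r1 + r2
  h<r = <-≤-trans (m<m+n h (s≤s z≤n)) h+2≤r
  minWeight+L : + minWeight r0 r1 h ℤ.+ L r0 r1 r2 h ≡ + suc (maxWeight r1 r2 h)
  minWeight+L = minWeight+L≡1+maxWeight r0 r1 r2 h<r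
  card≡L⇔ : (+ card ≡ L r0 r1 r2 h) ⇔ (minWeight r0 r1 h + card ≡ suc (maxWeight r1 r2 h))
  card≡L⇔ = mk⇔ (λ card≡L → ℤP.+-injective (trans (cong (ℤ._+_ (+ minWeight r0 r1 h)) card≡L) minWeight+L))
                (λ count → ∙-cancelˡ (+ minWeight r0 r1 h) (+ card) (L r0 r1 r2 h) (trans (cong +_ count) (sym minWeight+L)))
  card≡L-if-determined : ValueDeterminedByWeight → + card ≡ L r0 r1 r2 h
  card≡L-if-determined determined =
    Equivalence.from card≡L⇔ (minWeight+card≡1+maxWeight determined (some-coeff (<⇒≤ h<r)))
  part-i : r1 ≡ 1 → + card ≡ L r0 r1 r2 h
  part-i r1≡1 = card≡L-if-determined (r₁≡1⇒determined r1≡1)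
  part-ii : 2 ≤ r1 → (+ card ≡ L r0 r1 r2 h) ⇔ IsAP3 a0 a1 a2
  part-ii 2≤r1 = mk⇔ (λ card≡L → decidable-stable (_ ℤ.≟ _) (¬¬AP card≡L)) (card≡L-if-determined ∘ AP⇒determined)
    where
    ¬¬AP : + card ≡ L r0 r1 r2 h → ¬ ¬ IsAP3 a0 a1 a2
    ¬¬AP card≡L ¬ap with diamond-corner 1≤r0 2≤r1 1≤r2 2≤h h+2≤r
    ... | x , y , z , x<r0 , y+1<r1 , z<r2 , sum =
      1+n≰n (subst (2 + maxWeight r1 r2 h ≤_) (Equivalence.to card≡L⇔ card≡L)
                   (¬IsAP3⇒2+maxWeight≤minWeight+card ¬ap x<r0 y+1<r1 z<r2 sum))
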